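{- Let $\mathcal C\subseteq 2^{[n]}$ be a code and suppose that a neuron $i\in[n]$ is a piercing of $\mathcal C$ (i.e., a $k$-piercing for some $k$). Then $\mathcal C$ is inductively pierced if and only if $\mathcal C\setminus i$ is inductively pierced.
   Context: $[n]=\{1,\dots,n\}$. A code is a set $\mathcal C\subseteq 2^{[n]}$ satisfying the standing conventions: $\emptyset\in\mathcal C$; every neuron lies in some codeword; no two distinct neurons lie in exactly the same codewords. $[\sigma,\tau]=\{\gamma:\sigma\subseteq\gamma\subseteq\tau\}$ has rank $|\tau\setminus\sigma|$; the deletion $\mathcal C\setminus i$ is obtained by removing $i$ from every codeword (a code on the remaining neurons). A neuron $i$ is a $k$-piercing of $\mathcal C$ if there are $\sigma\subseteq\tau\subseteq[n]\setminus\{i\}$ with $[\sigma,\tau]$ of rank $k$, $[\sigma,\tau]\subseteq\mathcal C\setminus i$, and $\mathcal C=(\mathcal C\setminus i)\cup[\sigma\cup\{i\},\tau\cup\{i\}]$. $\mathcal C$ is $k$-inductively pierced if $\mathcal C=\{\emptyset\}$ or some neuron $i$ is a $k'$-piercing with $k'\le k$ and $\mathcal C\setminus i$ is $k$-inductively pierced; inductively pierced means $k$-inductively pierced for some $k$. -}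

module Defs where

open import Data.Nat using (ℕ; zero; suc; _≤_)
open import Data.Bool using (Bool; true; false; _∨_)
open import Data.Fin using (Fin)
open import Data.Fin.Subset using (Subset; _∈_; _∉_; _⊆_; ⊥; _─_; ∣_∣; inside; outside)
open import Data.Vec using (insertAt; removeAt)
open import Data.Product using (Σ; ∃; _×_; _,_)
open import Data.Sum using (_⊎_)
open import Relation.Binary.PropositionalEquality using (_≡_; _≢_)
open import Relation.Nullary using (¬_)
open import Function.Bundles using (_⇔_)

Code : ℕ → Set
Code n = Subset n → Bool

_∈C_ : ∀ {n} → Subset n → Code n → Set
γ ∈C C = C γ ≡ true

record IsCode {n : ℕ} (C : Code n) : Set where
  field
    empty∈   : ⊥ ∈C C
    covered  : ∀ (j : Fin n) → ∃ λ γ → γ ∈C C × j ∈ γ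
    separated : ∀ (j j' : Fin n) → j ≢ j' →
                ∃ λ γ → γ ∈C C × ¬ (j ∈ γ ⇔ j' ∈ γ)

-- deletion C ∖ i : remove neuron i from every codeword; a code on the
-- remaining n neurons (indexed by Fin n via the order-preserving relabelling).
delete : ∀ {n} → Fin (suc n) → Code (suc n) → Code n
delete i C τ = C (insertAt τ i outside) ∨ C (insertAt τ i inside)

IsTrivial : ∀ {n} → Code n → Set
IsTrivial {n} C = ∀ (γ : Subset n) → γ ∈C C ⇔ γ ≡ ⊥

Rank : ∀ {n} → Subset n → Subset n → ℕ → Set
Rank σ τ k = ∣ τ ─ σ ∣ ≡ k

Piercing : ∀ {n} → ℕ → Fin (suc n) → Code (suc n) → Set
Piercing {n} k i C =
  Σ (Subset n) λ σ → Σ (Subset n) λ τ →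
    σ ⊆ τ × Rank σ τ k ×
    (∀ (γ : Subset n) → σ ⊆ γ → γ ⊆ τ → γ ∈C delete i C) ×
    (∀ (γ : Subset (suc n)) →
       γ ∈C C ⇔ ((i ∉ γ × removeAt γ i ∈C delete i C)
                ⊎ (i ∈ γ × σ ⊆ removeAt γ i × removeAt γ i ⊆ τ)))

data IndPierced (k : ℕ) : (n : ℕ) → Code n → Set where
  trivial : ∀ {n} {C : Code n} → IsTrivial C → IndPierced k n C
  pierce  : ∀ {n} {C : Code (suc n)} (i : Fin (suc n)) (k' : ℕ) →
            k' ≤ k → Piercing k' i C → IndPierced k n (delete i C) →
            IndPierced k (suc n) C

InductivelyPierced : ∀ {n} → Code n → Set
InductivelyPierced {n} C = ∃ λ k → IndPierced k n C

{-# OPTIONS --safe #-}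
-- Seen from i, a k-piercing says two things: C is closed under removing i, and the
-- link {ρ : ρ ∪ {i} ∈ C} is an interval [σ, τ] of rank k.  Both survive the deletion
-- of another neuron j (the link becomes the projection of [σ, τ], of no larger rank),
-- and deletions of distinct neurons commute.  So if C is inductively pierced starting
-- with j ≠ i, induction on C ∖ j makes (C ∖ j) ∖ i = (C ∖ i) ∖ j inductively pierced,
-- and j pierces C ∖ i.  A trivial code has no piercing, and the converse direction is
-- a single piercing step.
module Submission where

open import Defs
open import Algebra.Bundles using (CommutativeMonoid)
open import Data.Bool using (Bool; true; false; _∨_)
open import Data.Bool.Properties using (∨-commutativeMonoid)
open import Data.Empty using (⊥-elim)
open import Data.Fin using (Fin; zero; suc; punchOut)
open import Data.Fin.Properties using (_≟_)
open import Data.Fin.Subset using (Subset; _∈_; _∉_; _⊆_; _─_; ∣_∣; inside; outside) renaming (⊥ to ∅)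
open import Data.Fin.Subset.Properties using (drop-∷-⊆; ∣p∣≤∣x∷p∣; ∉⊥; ⊆-refl)
open import Data.Nat using (ℕ; zero; suc; _≤_; _⊔_; s≤s)
open import Data.Nat.Properties using (≤-trans; m≤m⊔n; m≤n⊔m)
open import Data.Product using (∃; _×_; _,_)
open import Data.Product.Function.Dependent.Propositional using (Σ-⇔)
open import Data.Sum using (_⊎_; inj₁; inj₂; [_,_])
open import Data.Vec using (Vec; _∷_; insertAt; removeAt; lookup; here; there)
open import Data.Vec.Properties
  using (insertAt-lookup; removeAt-insertAt; insertAt-removeAt; []=⇒lookup; lookup⇒[]=)
open import Function using (id; _∘_)
open import Function.Bundles using (_⇔_; mk⇔; Equivalence)
open import Function.Construct.Identity using (↠-id)
open import Function.Properties.Equivalence using (⇔-setoid)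
open import Level using (0ℓ)
import Relation.Binary.Reasoning.Setoid as SetoidReasoning
open import Relation.Nullary using (¬_; yes; no)
open import Relation.Binary.PropositionalEquality using (_≡_; _≢_; _≗_; refl; sym; trans; cong; cong₂; subst)
open import Algebra.Properties.CommutativeSemigroup
  (CommutativeMonoid.commutativeSemigroup ∨-commutativeMonoid) using (interchange)

open Equivalence

∨≡true⇔ : ∀ {x y} → x ∨ y ≡ true ⇔ (x ≡ true ⊎ y ≡ true)
∨≡true⇔ {true}  = mk⇔ (λ _ → inj₁ refl) (λ _ → refl)
∨≡true⇔ {false} = mk⇔ inj₂ [ (λ ()) , id ]

∃-cong : ∀ {P Q : Bool → Set} → (∀ {b} → P b ⇔ Q b) → ∃ P ⇔ ∃ Q
∃-cong = Σ-⇔ (↠-id Bool)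

∈-delete⇔ : ∀ {n} (C : Code (suc n)) i ρ → ρ ∈C delete i C ⇔ ∃ λ b → insertAt ρ i b ∈C C
∈-delete⇔ C i ρ = mk⇔ split join
  where
  split : ρ ∈C delete i C → ∃ λ b → insertAt ρ i b ∈C C
  split h with to (∨≡true⇔ {C (insertAt ρ i outside)}) h
  ... | inj₁ h₀ = outside , h₀
  ... | inj₂ h₁ = inside , h₁
  join : (∃ λ b → insertAt ρ i b ∈C C) → ρ ∈C delete i C
  join (outside , h) = from ∨≡true⇔ (inj₁ h)
  join (inside  , h) = from ∨≡true⇔ (inj₂ h)

lookup-⊆ : ∀ {n} {p q : Subset n} (i : Fin n) → p ⊆ q → lookup p i ≡ true → lookup q i ≡ true
lookup-⊆ {p = p} i p⊆q e = []=⇒lookup (p⊆q (lookup⇒[]= i p e))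

∷-⊆ : ∀ {n b c} {p q : Subset n} → (b ≡ true → c ≡ true) → p ⊆ q → b ∷ p ⊆ c ∷ q
∷-⊆ b⇒c p⊆q here rewrite b⇒c refl = here
∷-⊆ b⇒c p⊆q (there x∈p) = there (p⊆q x∈p)

insertAt-⊆ : ∀ {n} {p q : Subset n} (i : Fin (suc n)) {b c} →
  (b ≡ true → c ≡ true) → p ⊆ q → insertAt p i b ⊆ insertAt q i c
insertAt-⊆ zero b⇒c p⊆q = ∷-⊆ b⇒c p⊆q
insertAt-⊆ {p = _ ∷ _} {_ ∷ _} (suc i) b⇒c p⊆q =
  ∷-⊆ (lookup-⊆ zero p⊆q) (insertAt-⊆ i b⇒c (drop-∷-⊆ p⊆q))

removeAt-⊆ : ∀ {n} {p q : Subset (suc n)} (i : Fin (suc n)) → p ⊆ q → removeAt p i ⊆ removeAt q i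
removeAt-⊆ {p = _ ∷ _} {_ ∷ _} zero = drop-∷-⊆
removeAt-⊆ {p = _ ∷ _ ∷ _} {_ ∷ _ ∷ _} (suc i) p⊆q =
  ∷-⊆ (lookup-⊆ zero p⊆q) (removeAt-⊆ i (drop-∷-⊆ p⊆q))

∈-insertAt-inside : ∀ {n} (ρ : Subset n) i → i ∈ insertAt ρ i inside
∈-insertAt-inside ρ i = lookup⇒[]= i _ (insertAt-lookup ρ i inside)

∉-insertAt-outside : ∀ {n} (ρ : Subset n) i → i ∉ insertAt ρ i outside
∉-insertAt-outside ρ i i∈ with trans (sym (insertAt-lookup ρ i outside)) ([]=⇒lookup i∈)
... | ()

∣∷∣-mono : ∀ {m n} x (p : Subset m) (q : Subset n) → ∣ p ∣ ≤ ∣ q ∣ → ∣ x ∷ p ∣ ≤ ∣ x ∷ q ∣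
∣∷∣-mono inside  _ _ = s≤s
∣∷∣-mono outside _ _ = id

∣removeAt∣≤ : ∀ {n} (p : Subset (suc n)) i → ∣ removeAt p i ∣ ≤ ∣ p ∣
∣removeAt∣≤ (x ∷ p)     zero    = ∣p∣≤∣x∷p∣ x p
∣removeAt∣≤ (x ∷ y ∷ p) (suc i) = ∣∷∣-mono x (removeAt (y ∷ p) i) (y ∷ p) (∣removeAt∣≤ (y ∷ p) i)

removeAt-─ : ∀ {n} (p q : Subset (suc n)) i → removeAt (p ─ q) i ≡ removeAt p i ─ removeAt q i
removeAt-─ (x ∷ p)     (y ∷ q)     zero    = refl
removeAt-─ (x ∷ x′ ∷ p) (y ∷ y′ ∷ q) (suc i) = cong (_ ∷_) (removeAt-─ (x′ ∷ p) (y′ ∷ q) i)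

rank-removeAt : ∀ {n} (σ τ : Subset (suc n)) i → ∣ removeAt τ i ─ removeAt σ i ∣ ≤ ∣ τ ─ σ ∣
rank-removeAt σ τ i = subst (_≤ ∣ τ ─ σ ∣) (cong ∣_∣ (removeAt-─ τ σ i)) (∣removeAt∣≤ (τ ─ σ) i)

_∈[_,_] : ∀ {n} → Subset n → Subset n → Subset n → Set
ρ ∈[ σ , τ ] = σ ⊆ ρ × ρ ⊆ τ

∃insertAt∈[]⇔removeAt : ∀ {n} {σ τ : Subset (suc n)} i {ρ} → σ ⊆ τ →
  (∃ λ b → insertAt ρ i b ∈[ σ , τ ]) ⇔ ρ ∈[ removeAt σ i , removeAt τ i ]
∃insertAt∈[]⇔removeAt {σ = σ} {τ} i {ρ} σ⊆τ = mk⇔ project lift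
  where
  project : (∃ λ b → insertAt ρ i b ∈[ σ , τ ]) → ρ ∈[ removeAt σ i , removeAt τ i ]
  project (b , σ⊆ , ⊆τ) = subst (removeAt σ i ⊆_) (removeAt-insertAt ρ i b) (removeAt-⊆ i σ⊆)
                        , subst (_⊆ removeAt τ i) (removeAt-insertAt ρ i b) (removeAt-⊆ i ⊆τ)
  lift : ρ ∈[ removeAt σ i , removeAt τ i ] → ∃ λ b → insertAt ρ i b ∈[ σ , τ ]
  lift (σ⊆ , ⊆τ) = lookup σ i
                 , subst (_⊆ insertAt ρ i (lookup σ i)) (insertAt-removeAt σ i) (insertAt-⊆ i id σ⊆)
                 , subst (insertAt ρ i (lookup σ i) ⊆_) (insertAt-removeAt τ i)
                     (insertAt-⊆ i (lookup-⊆ i σ⊆τ) ⊆τ)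

insertAt-insertAt : ∀ {A : Set} {n} (xs : Vec A n) {i j : Fin (suc (suc n))}
  (i≢j : i ≢ j) (j≢i : j ≢ i) a b →
  insertAt (insertAt xs (punchOut i≢j) b) i a ≡ insertAt (insertAt xs (punchOut j≢i) a) j b
insertAt-insertAt xs       {zero}  {zero}  i≢j j≢i a b = ⊥-elim (i≢j refl)
insertAt-insertAt xs       {zero}  {suc j} i≢j j≢i a b = refl
insertAt-insertAt xs       {suc i} {zero}  i≢j j≢i a b = refl
insertAt-insertAt {n = zero} xs {suc zero} {suc zero} i≢j j≢i a b = ⊥-elim (i≢j refl)
insertAt-insertAt (x ∷ xs) {suc i} {suc j} i≢j j≢i a b =
  cong (x ∷_) (insertAt-insertAt xs (i≢j ∘ cong suc) (j≢i ∘ cong suc) a b)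

delete-delete : ∀ {n} (C : Code (suc (suc n))) {i j} (i≢j : i ≢ j) (j≢i : j ≢ i) →
  delete (punchOut i≢j) (delete i C) ≗ delete (punchOut j≢i) (delete j C)
delete-delete C {i} {j} i≢j j≢i ρ =
  trans (interchange (c outside outside) (c inside outside) (c outside inside) (c inside inside))
  (cong₂ _∨_ (cong₂ _∨_ (swap outside outside) (swap outside inside))
             (cong₂ _∨_ (swap inside outside)  (swap inside inside)))
  where
  c : Bool → Bool → Bool
  c a b = C (insertAt (insertAt ρ (punchOut i≢j) b) i a)
  swap : ∀ a b → c a b ≡ C (insertAt (insertAt ρ (punchOut j≢i) a) j b)
  swap a b = cong C (insertAt-insertAt ρ i≢j j≢i a b)

record IntervalLink {n} (k : ℕ) (i : Fin (suc n)) (C : Code (suc n)) : Set where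
  field
    lower upper : Subset n
    lower⊆upper : lower ⊆ upper
    rank        : Rank lower upper k
    closed      : ∀ ρ → insertAt ρ i inside ∈C C → insertAt ρ i outside ∈C C
    link        : ∀ ρ → insertAt ρ i inside ∈C C ⇔ ρ ∈[ lower , upper ]

Piercing⇒IntervalLink : ∀ {n k} {C : Code (suc n)} {i} → Piercing k i C → IntervalLink k i C
Piercing⇒IntervalLink {C = C} {i} (σ , τ , σ⊆τ , rk , _ , pierced) =
  record { lower = σ ; upper = τ ; lower⊆upper = σ⊆τ ; rank = rk ; closed = closed ; link = link }
  where
  closed : ∀ ρ → insertAt ρ i inside ∈C C → insertAt ρ i outside ∈C C
  closed ρ h = from (pierced (insertAt ρ i outside))
    (inj₁ ( ∉-insertAt-outside ρ i
          , subst (_∈C delete i C) (sym (removeAt-insertAt ρ i outside))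
                  (from (∈-delete⇔ C i ρ) (inside , h))))
  link : ∀ ρ → insertAt ρ i inside ∈C C ⇔ ρ ∈[ σ , τ ]
  link ρ = mk⇔ inLink intoC
    where
    inLink : insertAt ρ i inside ∈C C → ρ ∈[ σ , τ ]
    inLink h with to (pierced (insertAt ρ i inside)) h
    ... | inj₁ (i∉ , _) = ⊥-elim (i∉ (∈-insertAt-inside ρ i))
    ... | inj₂ (_ , ρ∈) rewrite removeAt-insertAt ρ i inside = ρ∈
    intoC : ρ ∈[ σ , τ ] → insertAt ρ i inside ∈C C
    intoC ρ∈ = from (pierced (insertAt ρ i inside))
      (inj₂ (∈-insertAt-inside ρ i , subst (_∈[ σ , τ ]) (sym (removeAt-insertAt ρ i inside)) ρ∈))

IntervalLink⇒Piercing : ∀ {n k} {C : Code (suc n)} {i} → IntervalLink k i C → Piercing k i C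
IntervalLink⇒Piercing {n} {C = C} {i} L =
  lower , upper , lower⊆upper , rank , interval , λ γ → subst Pierced (insertAt-removeAt γ i) (pierced _ _)
  where
  open IntervalLink L
  interval : ∀ γ → lower ⊆ γ → γ ⊆ upper → γ ∈C delete i C
  interval γ σ⊆ ⊆τ = from (∈-delete⇔ C i γ) (inside , from (link γ) (σ⊆ , ⊆τ))
  Pierced : Subset (suc n) → Set
  Pierced γ = γ ∈C C ⇔ ((i ∉ γ × removeAt γ i ∈C delete i C)
                      ⊎ (i ∈ γ × lower ⊆ removeAt γ i × removeAt γ i ⊆ upper))
  pierced : ∀ ρ b → Pierced (insertAt ρ i b)
  pierced ρ outside rewrite removeAt-insertAt ρ i outside =
    mk⇔ (λ h → inj₁ (∉-insertAt-outside ρ i , from (∈-delete⇔ C i ρ) (outside , h))) back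
    where
    back : _ → insertAt ρ i outside ∈C C
    back (inj₁ (_ , h)) with to (∈-delete⇔ C i ρ) h
    ... | outside , h₀ = h₀
    ... | inside  , h₁ = closed ρ h₁
    back (inj₂ (i∈ , _)) = ⊥-elim (∉-insertAt-outside ρ i i∈)
  pierced ρ inside rewrite removeAt-insertAt ρ i inside =
    mk⇔ (λ h → inj₂ (∈-insertAt-inside ρ i , to (link ρ) h)) back
    where
    back : _ → insertAt ρ i inside ∈C C
    back (inj₁ (i∉ , _))  = ⊥-elim (i∉ (∈-insertAt-inside ρ i))
    back (inj₂ (_ , ρ∈)) = from (link ρ) ρ∈

IntervalLink-delete : ∀ {n k} {C : Code (suc (suc n))} {i j} (i≢j : i ≢ j) (j≢i : j ≢ i) →
  IntervalLink k j C → ∃ λ k′ → k′ ≤ k × IntervalLink k′ (punchOut i≢j) (delete i C)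
IntervalLink-delete {C = C} {i} {j} i≢j j≢i L =
  _ , subst (∣ removeAt upper i′ ─ removeAt lower i′ ∣ ≤_) rank (rank-removeAt lower upper i′) ,
  record { lower = removeAt lower i′ ; upper = removeAt upper i′
         ; lower⊆upper = removeAt-⊆ i′ lower⊆upper ; rank = refl
         ; closed = closed′ ; link = link′ }
  where
  open IntervalLink L
  i′ = punchOut j≢i
  j′ = punchOut i≢j
  swap : ∀ ρ a b → insertAt (insertAt ρ j′ b) i a ≡ insertAt (insertAt ρ i′ a) j b
  swap ρ = insertAt-insertAt ρ i≢j j≢i
  closed′ : ∀ ρ → insertAt ρ j′ inside ∈C delete i C → insertAt ρ j′ outside ∈C delete i C
  closed′ ρ h with to (∈-delete⇔ C i (insertAt ρ j′ inside)) h
  ... | a , h′ = from (∈-delete⇔ C i (insertAt ρ j′ outside))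
    (a , subst (_∈C C) (sym (swap ρ a outside))
                (closed (insertAt ρ i′ a) (subst (_∈C C) (swap ρ a inside) h′)))
  link′ : ∀ ρ → insertAt ρ j′ inside ∈C delete i C ⇔ ρ ∈[ removeAt lower i′ , removeAt upper i′ ]
  link′ ρ = begin
      insertAt ρ j′ inside ∈C delete i C                    ≈⟨ ∈-delete⇔ C i _ ⟩
      (∃ λ a → insertAt (insertAt ρ j′ inside) i a ∈C C)     ≈⟨ ∃-cong (λ {a} → swapped-link a) ⟩
      (∃ λ a → insertAt ρ i′ a ∈[ lower , upper ])           ≈⟨ ∃insertAt∈[]⇔removeAt i′ lower⊆upper ⟩
      ρ ∈[ removeAt lower i′ , removeAt upper i′ ]           ∎
    where
    open SetoidReasoning (⇔-setoid 0ℓ)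
    swapped-link : ∀ a → insertAt (insertAt ρ j′ inside) i a ∈C C ⇔ insertAt ρ i′ a ∈[ lower , upper ]
    swapped-link a = subst (λ γ → γ ∈C C ⇔ insertAt ρ i′ a ∈[ lower , upper ])
                           (sym (swap ρ a inside)) (link (insertAt ρ i′ a))

Piercing-delete : ∀ {n k} {C : Code (suc (suc n))} {i j} (i≢j : i ≢ j) (j≢i : j ≢ i) →
  Piercing k j C → ∃ λ k′ → k′ ≤ k × Piercing k′ (punchOut i≢j) (delete i C)
Piercing-delete i≢j j≢i p with IntervalLink-delete i≢j j≢i (Piercing⇒IntervalLink p)
... | k′ , k′≤k , L = k′ , k′≤k , IntervalLink⇒Piercing L

IsTrivial⇒¬IntervalLink : ∀ {n k} {C : Code (suc n)} {i} → IsTrivial C → ¬ IntervalLink k i C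
IsTrivial⇒¬IntervalLink {i = i} only-∅ L = ∉⊥ (subst (i ∈_) lower+i≡∅ (∈-insertAt-inside lower i))
  where
  open IntervalLink L
  lower+i≡∅ : insertAt lower i inside ≡ ∅
  lower+i≡∅ = to (only-∅ _) (from (link lower) (⊆-refl , lower⊆upper))

delete-resp-≗ : ∀ {n} {C C′ : Code (suc n)} i → C ≗ C′ → delete i C ≗ delete i C′
delete-resp-≗ i C≗C′ γ = cong₂ _∨_ (C≗C′ _) (C≗C′ _)

IntervalLink-resp-≗ : ∀ {n k} {C C′ : Code (suc n)} {i} → C ≗ C′ → IntervalLink k i C → IntervalLink k i C′
IntervalLink-resp-≗ {i = i} C≗C′ L = record
  { lower = lower ; upper = upper ; lower⊆upper = lower⊆upper ; rank = rank
  ; closed = λ ρ h → trans (sym (C≗C′ _)) (closed ρ (trans (C≗C′ _) h))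
  ; link   = λ ρ → subst (λ b → b ≡ true ⇔ ρ ∈[ lower , upper ]) (C≗C′ (insertAt ρ i inside)) (link ρ)
  }
  where open IntervalLink L

IndPierced-resp-≗ : ∀ {k n} {C C′ : Code n} → C ≗ C′ → IndPierced k n C → IndPierced k n C′
IndPierced-resp-≗ C≗C′ (trivial only-∅) =
  trivial (λ γ → subst (λ b → b ≡ true ⇔ γ ≡ ∅) (C≗C′ γ) (only-∅ γ))
IndPierced-resp-≗ C≗C′ (pierce i k′ k′≤k p rest) =
  pierce i k′ k′≤k (IntervalLink⇒Piercing (IntervalLink-resp-≗ C≗C′ (Piercing⇒IntervalLink p)))
    (IndPierced-resp-≗ (delete-resp-≗ i C≗C′) rest)

IndPierced-mono : ∀ {k l n} {C : Code n} → k ≤ l → IndPierced k n C → IndPierced l n C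
IndPierced-mono k≤l (trivial only-∅)          = trivial only-∅
IndPierced-mono k≤l (pierce i k′ k′≤k p rest) = pierce i k′ (≤-trans k′≤k k≤l) p (IndPierced-mono k≤l rest)

IndPierced-delete : ∀ {k n} {C : Code (suc n)} i → (∃ λ kᵢ → Piercing kᵢ i C) →
  IndPierced k (suc n) C → IndPierced k n (delete i C)
IndPierced-delete i (_ , pᵢ) (trivial only-∅) =
  ⊥-elim (IsTrivial⇒¬IntervalLink only-∅ (Piercing⇒IntervalLink pᵢ))
IndPierced-delete {n = zero} zero _ (pierce zero _ _ _ rest) = rest
IndPierced-delete {n = suc n} {C} i (_ , pᵢ) (pierce j kⱼ kⱼ≤k pⱼ rest) with i ≟ j
... | yes refl = rest
... | no i≢j
  with Piercing-delete i≢j (i≢j ∘ sym) pⱼ | Piercing-delete (i≢j ∘ sym) i≢j pᵢ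
...  | kⱼ′ , kⱼ′≤kⱼ , pⱼ′ | kᵢ′ , _ , pᵢ′ =
  pierce (punchOut i≢j) kⱼ′ (≤-trans kⱼ′≤kⱼ kⱼ≤k) pⱼ′
    (IndPierced-resp-≗ (λ ρ → sym (delete-delete C i≢j (i≢j ∘ sym) ρ))
      (IndPierced-delete (punchOut (i≢j ∘ sym)) (kᵢ′ , pᵢ′) rest))

proposition3 : ∀ {n : ℕ} (C : Code (suc n)) → IsCode C → (i : Fin (suc n)) →
    (∃ λ k → Piercing k i C) →
    (InductivelyPierced C ⇔ InductivelyPierced (delete i C))
proposition3 C _ i (kᵢ , pᵢ) = mk⇔
  (λ (k , C-pierced) → k , IndPierced-delete i (kᵢ , pᵢ) C-pierced)
  (λ (k , C∖i-pierced) →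
     k ⊔ kᵢ , pierce i kᵢ (m≤n⊔m k kᵢ) pᵢ (IndPierced-mono (m≤m⊔n k kᵢ) C∖i-pierced))
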